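{- Let $\Delta$ be a finite saturated sample set, $\delta$ a $\Delta$-diagram, and $t$ a basic term. If a time warp $f$ strongly extends $\mathrm{diag}_t(\delta)$, then $f'$ strongly extends $\mathrm{diag}_{t'}(\delta)$.
   Context: Let $\omega^+=\omega\cup\{\omega\}$ with its natural order; $S(n)=n+1$ for $n\in\omega$, $S(\omega)=\omega$. A time warp is a join-preserving map $\omega^+\to\omega^+$ (equivalently, order-preserving with $f(0)=0$ and $f(\omega)=\sup_{n\in\omega}f(n)$); $\mathrm{last}(f)=\min\{m\in\omega^+\mid f(m)=f(\omega)\}$. With $p$ the predecessor time warp ($p(0)=0$, $p(\omega)=\omega$, $p(m)=m-1$ otherwise), $f'$ is the largest time warp $g$ with $f\circ g\le p$ pointwise. Basic terms are built from variables using $\cdot$, ${}'$, $1$. Samples: fix a countably infinite set of time variables $\kappa$. Samples are generated by $\alpha::=\kappa\mid t[\alpha]\mid\mathrm{suc}(\alpha)\mid\mathrm{last}(t)$ with $t$ basic (purely syntactic). Let $\leadsto$ be given, for basic $t,u$ and samples $\alpha$, by: $t[\alpha]\leadsto\alpha$; $(t\cdot u)[\alpha]\leadsto t[u[\alpha]]$; $\mathrm{suc}(\alpha)\leadsto\alpha$; $t'[\alpha]\leadsto t[t'[\alpha]]$; $t[\alpha]\leadsto t[\mathrm{last}(t)]$; $t'[\alpha]\leadsto t[\mathrm{suc}(t'[\alpha])]$. $\Delta$ is saturated if $\alpha\in\Delta$, $\alpha\leadsto\beta$ imply $\beta\in\Delta$. A $\Delta$-diagram is a map $\delta\colon\Delta\to\omega^+$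 such that: (1) $t[\alpha],t[\beta]\in\Delta$, $\delta(\alpha)\le\delta(\beta)$ imply $\delta(t[\alpha])\le\delta(t[\beta])$; (2) $t[\alpha]\in\Delta$, $\delta(\alpha)=0$ imply $\delta(t[\alpha])=0$; (3) $\mathrm{suc}(\alpha)\in\Delta$ implies $\delta(\mathrm{suc}(\alpha))=S(\delta(\alpha))$; (4) for $t[\alpha]\in\Delta$: $\delta(\mathrm{last}(t))\le\delta(\alpha)$ iff $\delta(t[\mathrm{last}(t)])=\delta(t[\alpha])$; (5) $t[\mathrm{last}(t)]\in\Delta$, $\delta(\mathrm{last}(t))=\omega$ imply $\delta(t[\mathrm{last}(t)])=\omega$; (6) $1[\alpha]\in\Delta$ implies $\delta(1[\alpha])=\delta(\alpha)$; (7) $\mathrm{last}(1)\in\Delta$ implies $\delta(\mathrm{last}(1))=\omega$; (8) $(t\cdot u)[\alpha]\in\Delta$ implies $\delta((t\cdot u)[\alpha])=\delta(t[u[\alpha]])$; (9) $\mathrm{last}(t\cdot u),\mathrm{last}(t),\mathrm{last}(u)\in\Delta$, $\delta(\mathrm{last}(t\cdot u))=\omega$ imply $\delta(\mathrm{last}(t))=\delta(\mathrm{last}(u))=\omega$; (10) $t'[\alpha]\in\Delta$, $0<\delta(\alpha)<\omega$ imply $\delta(t[t'[\alpha]])<\delta(\alpha)$; (11) $t'[\alpha]\in\Delta$, $\delta(t'[\alpha])<\omega$ imply $\delta(\alpha)\le\delta(t[\mathrm{suc}(t'[\alpha])])$; (12) $\mathrm{last}(t'),\mathrm{last}(t)\in\Delta$,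 $\delta(\mathrm{last}(t'))=\omega$ imply $\delta(\mathrm{last}(t))=\omega$. For a basic term $t$, $\mathrm{diag}_t(\delta)=\{(\delta(\alpha),\delta(t[\alpha]))\mid t[\alpha]\in\Delta\}$. A time warp $f$ extends $\mathrm{diag}_t(\delta)$ if $f(i)=j$ for all $(i,j)\in\mathrm{diag}_t(\delta)$; it strongly extends $\mathrm{diag}_t(\delta)$ if it extends it and, whenever $\mathrm{diag}_t(\delta)\neq\emptyset$ and $\delta(\mathrm{last}(t))=\omega$, also $\mathrm{last}(f)=\omega$. -}

module Defs where

open import Data.Nat using (ℕ; zero; suc) renaming (_≤_ to _≤ℕ_; _<_ to _<ℕ_)
open import Data.List using (List)
open import Data.List.Membership.Propositional using (_∈_)
open import Data.Product using (Σ; _×_; ∃)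
open import Relation.Binary.PropositionalEquality using (_≡_)

data ω⁺ : Set where
  fin : ℕ → ω⁺
  ω   : ω⁺

infix 4 _≤w_ _<w_

data _≤w_ : ω⁺ → ω⁺ → Set where
  fin≤fin : ∀ {m n} → m ≤ℕ n → fin m ≤w fin n
  ≤ω      : ∀ {x} → x ≤w ω

data _<w_ : ω⁺ → ω⁺ → Set where
  fin<fin : ∀ {m n} → m <ℕ n → fin m <w fin n
  fin<ω   : ∀ {m} → fin m <w ω

S : ω⁺ → ω⁺
S (fin n) = fin (suc n)
S ω       = ω

pred⁺ : ω⁺ → ω⁺
pred⁺ (fin zero)    = fin zero
pred⁺ (fin (suc n)) = fin n
pred⁺ ω             = ω

record TimeWarp (f : ω⁺ → ω⁺) : Set where
  field
    mono      : ∀ x y → x ≤w y → f x ≤w f y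
    zero-pres : f (fin zero) ≡ fin zero
    sup-ub    : ∀ n → f (fin n) ≤w f ω
    sup-least : ∀ u → (∀ n → f (fin n) ≤w u) → f ω ≤w u

IsLast : (ω⁺ → ω⁺) → ω⁺ → Set
IsLast f m = (f m ≡ f ω) × (∀ k → f k ≡ f ω → m ≤w k)

IsDerivative : (ω⁺ → ω⁺) → (ω⁺ → ω⁺) → Set
IsDerivative f g =
  TimeWarp g
  × (∀ x → f (g x) ≤w pred⁺ x)
  × (∀ h → TimeWarp h → (∀ x → f (h x) ≤w pred⁺ x) → ∀ x → h x ≤w g x)

infixl 7 _·_
data Term : Set where
  var : ℕ → Term
  _·_ : Term → Term → Term
  _′  : Term → Term
  one : Term

data Sample : Set where
  κ     : ℕ → Sample
  _[_]  : Term → Sample → Sample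
  sucS  : Sample → Sample
  lastS : Term → Sample

infix 4 _⇝_
data _⇝_ : Sample → Sample → Set where
  r-arg  : ∀ t α → t [ α ] ⇝ α
  r-comp : ∀ t u α → (t · u) [ α ] ⇝ t [ u [ α ] ]
  r-suc  : ∀ α → sucS α ⇝ α
  r-der  : ∀ t α → (t ′) [ α ] ⇝ t [ (t ′) [ α ] ]
  r-last : ∀ t α → t [ α ] ⇝ t [ lastS t ]
  r-ders : ∀ t α → (t ′) [ α ] ⇝ t [ sucS ((t ′) [ α ]) ]

-- finite sample sets are given as lists
Saturated : List Sample → Set
Saturated Δ = ∀ α β → α ∈ Δ → α ⇝ β → β ∈ Δ

-- Δ-diagrams (δ is given as a total function; only its values on Δ matter)

record IsDiagram (Δ : List Sample) (δ : Sample → ω⁺) : Set where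
  field
    c1  : ∀ t α β → t [ α ] ∈ Δ → t [ β ] ∈ Δ → δ α ≤w δ β → δ (t [ α ]) ≤w δ (t [ β ])
    c2  : ∀ t α → t [ α ] ∈ Δ → δ α ≡ fin zero → δ (t [ α ]) ≡ fin zero
    c3  : ∀ α → sucS α ∈ Δ → δ (sucS α) ≡ S (δ α)
    c4⇒ : ∀ t α → t [ α ] ∈ Δ → δ (lastS t) ≤w δ α → δ (t [ lastS t ]) ≡ δ (t [ α ])
    c4⇐ : ∀ t α → t [ α ] ∈ Δ → δ (t [ lastS t ]) ≡ δ (t [ α ]) → δ (lastS t) ≤w δ α
    c5  : ∀ t → t [ lastS t ] ∈ Δ → δ (lastS t) ≡ ω → δ (t [ lastS t ]) ≡ ω
    c6  : ∀ α → one [ α ] ∈ Δ → δ (one [ α ]) ≡ δ α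
    c7  : lastS one ∈ Δ → δ (lastS one) ≡ ω
    c8  : ∀ t u α → (t · u) [ α ] ∈ Δ → δ ((t · u) [ α ]) ≡ δ (t [ u [ α ] ])
    c9  : ∀ t u → lastS (t · u) ∈ Δ → lastS t ∈ Δ → lastS u ∈ Δ →
          δ (lastS (t · u)) ≡ ω → (δ (lastS t) ≡ ω) × (δ (lastS u) ≡ ω)
    c10 : ∀ t α → (t ′) [ α ] ∈ Δ → fin zero <w δ α → δ α <w ω →
          δ (t [ (t ′) [ α ] ]) <w δ α
    c11 : ∀ t α → (t ′) [ α ] ∈ Δ → δ ((t ′) [ α ]) <w ω →
          δ α ≤w δ (t [ sucS ((t ′) [ α ]) ])
    c12 : ∀ t → lastS (t ′) ∈ Δ → lastS t ∈ Δ → δ (lastS (t ′)) ≡ ω → δ (lastS t) ≡ ω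

-- diag_t(δ) = { (δ α, δ (t[α])) | t[α] ∈ Δ } and (strong) extension

Extends : List Sample → (Sample → ω⁺) → Term → (ω⁺ → ω⁺) → Set
Extends Δ δ t f = ∀ α → t [ α ] ∈ Δ → f (δ α) ≡ δ (t [ α ])

DiagNonEmpty : List Sample → Term → Set
DiagNonEmpty Δ t = ∃ λ α → t [ α ] ∈ Δ

StronglyExtends : List Sample → (Sample → ω⁺) → Term → (ω⁺ → ω⁺) → Set
StronglyExtends Δ δ t f =
  Extends Δ δ t f × (DiagNonEmpty Δ t → δ (lastS t) ≡ ω → IsLast f ω)

-- Write c = δ(t′[α]). Axioms (10) and (11) of a diagram say f c < δ α ≤ f (S c) (where
-- meaningful), and at a finite successor point n these two inequalities pin f′ down:
-- f′ (n) is the largest b with f b ≤ n - 1. Hence f′ (δ α) = c for finite δ α. For δ α = ω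
-- one compares with the sample t′[last(t′)]: if its time is finite, axiom (4) gives
-- f′ (δ(last t′)) = c and (11) forces f to jump to ω right after c, so f′ stays at c up to
-- ω; if it is ω, axiom (12) and the strong extension give last(f) = ω, which makes f finite
-- on finite arguments, so c = ω = f′ ω, and this also yields last(f′) = ω.
module Submission where

open import Defs
open import Data.List using (List)
open import Data.List.Membership.Propositional using (_∈_)
open import Data.Nat using (ℕ; zero; suc; _≤?_; _<?_; z≤n; s≤s)
open import Data.Nat.Properties using (≤-refl; ≤-trans; ≤-antisym; 1+n≰n; ≤∧≢⇒<; <⇒≤pred; ≰⇒>)
open import Data.Product using (_,_; proj₁; proj₂)
open import Data.Sum using (_⊎_; inj₁; inj₂)
open import Relation.Nullary using (¬_; yes; no; contradiction)
open import Relation.Binary.PropositionalEquality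
  using (_≡_; _≢_; refl; sym; trans; cong; subst; subst₂)

≤w-refl : ∀ {x} → x ≤w x
≤w-refl {fin n} = fin≤fin ≤-refl
≤w-refl {ω}     = ≤ω

≤w-reflexive : ∀ {x y} → x ≡ y → x ≤w y
≤w-reflexive refl = ≤w-refl

≤w-trans : ∀ {x y z} → x ≤w y → y ≤w z → x ≤w z
≤w-trans (fin≤fin p) (fin≤fin q) = fin≤fin (≤-trans p q)
≤w-trans _           ≤ω          = ≤ω

≤w-antisym : ∀ {x y} → x ≤w y → y ≤w x → x ≡ y
≤w-antisym (fin≤fin p) (fin≤fin q) = cong fin (≤-antisym p q)
≤w-antisym ≤ω          ≤ω          = refl

z≤w : ∀ {x} → fin zero ≤w x
z≤w {fin n} = fin≤fin z≤n
z≤w {ω}     = ≤ω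

ω≤w⇒≡ω : ∀ {x} → ω ≤w x → x ≡ ω
ω≤w⇒≡ω ≤ω = refl

1+n≰wn : ∀ {n} → ¬ fin (suc n) ≤w fin n
1+n≰wn (fin≤fin p) = 1+n≰n p

≤w-fin-dichotomy : ∀ x j → x ≤w fin j ⊎ fin (suc j) ≤w x
≤w-fin-dichotomy (fin m) j with m ≤? j
... | yes m≤j = inj₁ (fin≤fin m≤j)
... | no  m≰j = inj₂ (fin≤fin (≰⇒> m≰j))
≤w-fin-dichotomy ω       j = inj₂ ≤ω

<w-suc⇒≤w : ∀ {x k} → x <w fin (suc k) → x ≤w fin k
<w-suc⇒≤w (fin<fin p) = fin≤fin (<⇒≤pred p)

≤w∧≢⇒≤w-pred : ∀ {x i} → x ≤w fin (suc i) → x ≢ fin (suc i) → x ≤w fin i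
≤w∧≢⇒≤w-pred (fin≤fin p) x≢ = fin≤fin (<⇒≤pred (≤∧≢⇒< p (λ eq → x≢ (cong fin eq))))

≢ω⇒<ω : ∀ {x} → x ≢ ω → x <w ω
≢ω⇒<ω {fin n} _   = fin<ω
≢ω⇒<ω {ω}     x≢ = contradiction refl x≢

<ω⇒≢ω : ∀ {x} → x <w ω → x ≢ ω
<ω⇒≢ω fin<ω ()

≮ω⇒≡ω : ∀ {x} → ¬ x <w ω → x ≡ ω
≮ω⇒≡ω {fin n} x≮ω = contradiction fin<ω x≮ω
≮ω⇒≡ω {ω}     _   = refl

ω≰wfin : ∀ {n} → ¬ ω ≤w fin n
ω≰wfin ()

unbounded⇒ω : ∀ {x} → (∀ m → fin m ≤w x) → x ≡ ω
unbounded⇒ω {fin n} above = contradiction (above (suc n)) 1+n≰wn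
unbounded⇒ω {ω}     _     = refl

module _ {f : ω⁺ → ω⁺} (tw : TimeWarp f) where
  open TimeWarp tw

  supremum-unattained⇒ω : (∀ n → f (fin n) ≢ f ω) → f ω ≡ ω
  supremum-unattained⇒ω unattained = go (f ω) refl
    where
    go : ∀ x → f ω ≡ x → f ω ≡ ω
    go ω             fω≡ω = fω≡ω
    go (fin zero)    fω≡0 = contradiction (trans zero-pres (sym fω≡0)) (unattained zero)
    go (fin (suc i)) fω≡x = contradiction (subst (_≤w fin i) fω≡x (sup-least (fin i) below)) 1+n≰wn
      where
      below : ∀ n → f (fin n) ≤w fin i
      below n = ≤w∧≢⇒≤w-pred (subst (f (fin n) ≤w_) fω≡x (sup-ub n))
                              (λ eq → unattained n (trans eq (sym fω≡x)))

  isLast-ω⇒ω : IsLast f ω → f ω ≡ ω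
  isLast-ω⇒ω (_ , least) = supremum-unattained⇒ω λ n eq → ω≰wfin (least (fin n) eq)

  isLast-ω⇒finite : IsLast f ω → ∀ n → f (fin n) <w ω
  isLast-ω⇒finite last n = ≢ω⇒<ω λ eq → ω≰wfin (proj₂ last (fin n) (trans eq (sym (isLast-ω⇒ω last))))

finite⇒isLast-ω : ∀ {f} → f ω ≡ ω → (∀ n → f (fin n) <w ω) → IsLast f ω
finite⇒isLast-ω {f} fω≡ω finite = refl , least
  where
  least : ∀ k → f k ≡ f ω → ω ≤w k
  least (fin n) eq = contradiction (trans eq fω≡ω) (<ω⇒≢ω (finite n))
  least ω       _  = ≤ω

step : ℕ → ω⁺ → ω⁺ → ω⁺
step k b (fin m) with k <? m
... | yes _ = b
... | no  _ = fin zero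
step k b ω = b

step-after : ∀ k b → step k b (fin (suc k)) ≡ b
step-after k b with k <? suc k
... | yes _   = refl
... | no  k≮k = contradiction ≤-refl k≮k

step≤ : ∀ k b x → step k b x ≤w b
step≤ k b (fin m) with k <? m
... | yes _ = ≤w-refl
... | no  _ = z≤w
step≤ k b ω = ≤w-refl

step-timeWarp : ∀ k b → TimeWarp (step k b)
step-timeWarp k b = record
  { mono      = mono
  ; zero-pres = zero-pres
  ; sup-ub    = λ n → step≤ k b (fin n)
  ; sup-least = λ u bound → subst (_≤w u) (step-after k b) (bound (suc k))
  }
  where
  mono : ∀ x y → x ≤w y → step k b x ≤w step k b y
  mono (fin m) (fin n) (fin≤fin m≤n) with k <? m | k <? n
  ... | yes _   | yes _   = ≤w-refl
  ... | yes k<m | no  k≮n = contradiction (≤-trans k<m m≤n) k≮n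
  ... | no  _   | _       = z≤w
  mono x ω ≤ω = step≤ k b x
  zero-pres : step k b (fin zero) ≡ fin zero
  zero-pres with k <? zero
  ... | no _ = refl

module Derivative {f f′ : ω⁺ → ω⁺} (tw : TimeWarp f) (der : IsDerivative f f′) where
  module F = TimeWarp tw
  module F′ = TimeWarp (proj₁ der)

  private
    f∘f′≤pred : ∀ x → f (f′ x) ≤w pred⁺ x
    f∘f′≤pred = proj₁ (proj₂ der)
    maximal : ∀ h → TimeWarp h → (∀ x → f (h x) ≤w pred⁺ x) → ∀ x → h x ≤w f′ x
    maximal = proj₂ (proj₂ der)

  f≤⇒≤f′ : ∀ {b k} → f b ≤w fin k → b ≤w f′ (fin (suc k))
  f≤⇒≤f′ {b} {k} fb≤k =
    subst (_≤w f′ (fin (suc k))) (step-after k b)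
          (maximal (step k b) (step-timeWarp k b) below (fin (suc k)))
    where
    below : ∀ x → f (step k b x) ≤w pred⁺ x
    below (fin m) with k <? m
    below (fin (suc m)) | yes (s≤s k≤m) = ≤w-trans fb≤k (fin≤fin k≤m)
    ... | no _ = ≤w-trans (≤w-reflexive F.zero-pres) z≤w
    below ω = ≤ω

  ≤f′⇒f≤ : ∀ {b k} → b ≤w f′ (fin (suc k)) → f b ≤w fin k
  ≤f′⇒f≤ {b} {k} b≤f′ = ≤w-trans (F.mono _ _ b≤f′) (f∘f′≤pred (fin (suc k)))

  f′-at-suc : ∀ {c k} → f c ≤w fin k → (c <w ω → fin (suc k) ≤w f (S c)) → f′ (fin (suc k)) ≡ c
  f′-at-suc {ω}     fc≤k _    = ≤w-antisym ≤ω (f≤⇒≤f′ fc≤k)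
  f′-at-suc {fin j} {k} fc≤k jump = ≤w-antisym upper (f≤⇒≤f′ fc≤k)
    where
    upper : f′ (fin (suc k)) ≤w fin j
    upper with ≤w-fin-dichotomy (f′ (fin (suc k))) j
    ... | inj₁ f′≤j = f′≤j
    ... | inj₂ j<f′ = contradiction (≤w-trans (jump fin<ω) (≤f′⇒f≤ j<f′)) 1+n≰wn

  f′ω≤ : ∀ {j} → f (fin (suc j)) ≡ ω → f′ ω ≤w fin j
  f′ω≤ {j} f[1+j]≡ω = F′.sup-least (fin j) below
    where
    below : ∀ m → f′ (fin m) ≤w fin j
    below zero    = subst (_≤w fin j) (sym F′.zero-pres) z≤w
    below (suc k) with ≤w-fin-dichotomy (f′ (fin (suc k))) j
    ... | inj₁ f′≤j = f′≤j
    ... | inj₂ j<f′ = contradiction (subst (_≤w fin k) f[1+j]≡ω (≤f′⇒f≤ j<f′)) ω≰wfin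

  f′-at-ω : ∀ {x c} → f′ x ≡ c → (c <w ω → f (S c) ≡ ω) → f′ ω ≡ c
  f′-at-ω {x} f′x≡c jump = ≤w-antisym (upper _ f′x≡c jump) (subst (_≤w f′ ω) f′x≡c (F′.mono x ω ≤ω))
    where
    upper : ∀ c → f′ x ≡ c → (c <w ω → f (S c) ≡ ω) → f′ ω ≤w c
    upper ω       _ _     = ≤ω
    upper (fin j) _ jump′ = f′ω≤ (jump′ fin<ω)

  f′-unbounded : (∀ n → f (fin n) <w ω) → f′ ω ≡ ω
  f′-unbounded finite = unbounded⇒ω above
    where
    above : ∀ m → fin m ≤w f′ ω
    above m with f (fin m) in fm≡ | finite m
    ... | fin j | fin<ω = ≤w-trans (f≤⇒≤f′ (≤w-reflexive fm≡)) (F′.sup-ub (suc j))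

  f′-finite : f ω ≡ ω → ∀ m → f′ (fin m) <w ω
  f′-finite fω≡ω zero    = subst (_<w ω) (sym F′.zero-pres) fin<ω
  f′-finite fω≡ω (suc k) = ≢ω⇒<ω λ f′≡ω →
    ω≰wfin (subst (_≤w fin k) fω≡ω (≤f′⇒f≤ (≤w-reflexive (sym f′≡ω))))

  isLast-ω-derivative : IsLast f ω → IsLast f′ ω
  isLast-ω-derivative last =
    finite⇒isLast-ω (f′-unbounded (isLast-ω⇒finite tw last)) (f′-finite (isLast-ω⇒ω tw last))

module Lemma3p6 {Δ : List Sample} {δ : Sample → ω⁺} {t : Term} {f f′ : ω⁺ → ω⁺}
  (sat : Saturated Δ) (D : IsDiagram Δ δ) (tw : TimeWarp f) (der : IsDerivative f f′)
  (SE : StronglyExtends Δ δ t f) where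
  open IsDiagram D
  open Derivative tw der

  ext : Extends Δ δ t f
  ext = proj₁ SE

  module _ {α : Sample} (t′α∈Δ : (t ′) [ α ] ∈ Δ) where
    t[t′α]∈Δ : t [ (t ′) [ α ] ] ∈ Δ
    t[t′α]∈Δ = sat _ _ t′α∈Δ (r-der t α)

    t[suc-t′α]∈Δ : t [ sucS ((t ′) [ α ]) ] ∈ Δ
    t[suc-t′α]∈Δ = sat _ _ t′α∈Δ (r-ders t α)

    t′[last-t′]∈Δ : (t ′) [ lastS (t ′) ] ∈ Δ
    t′[last-t′]∈Δ = sat _ _ t′α∈Δ (r-last (t ′) α)

    f-below : ∀ {k} → δ α ≡ fin (suc k) → f (δ ((t ′) [ α ])) ≤w fin k
    f-below δα≡ = <w-suc⇒≤w (subst₂ _<w_ (sym (ext _ t[t′α]∈Δ)) δα≡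
      (c10 t α t′α∈Δ (subst (fin zero <w_) (sym δα≡) (fin<fin (s≤s z≤n))) (subst (_<w ω) (sym δα≡) fin<ω)))

    f-above : ∀ {x} → δ α ≡ x → δ ((t ′) [ α ]) <w ω → x ≤w f (S (δ ((t ′) [ α ])))
    f-above refl c<ω = subst (δ α ≤w_) f[S-c]≡ (c11 t α t′α∈Δ c<ω)
      where
      f[S-c]≡ : δ (t [ sucS ((t ′) [ α ]) ]) ≡ f (S (δ ((t ′) [ α ])))
      f[S-c]≡ = trans (sym (ext _ t[suc-t′α]∈Δ)) (cong f (c3 _ (sat _ _ t[suc-t′α]∈Δ (r-arg t _))))

    isLast-f : δ (lastS (t ′)) ≡ ω → IsLast f ω
    isLast-f last-t′≡ω = proj₂ SE (_ , t[t′α]∈Δ) (c12 t last-t′∈Δ last-t∈Δ last-t′≡ω)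
      where
      last-t′∈Δ : lastS (t ′) ∈ Δ
      last-t′∈Δ = sat _ _ t′[last-t′]∈Δ (r-arg (t ′) _)
      last-t∈Δ : lastS t ∈ Δ
      last-t∈Δ = sat _ _ (sat _ _ t[t′α]∈Δ (r-last t _)) (r-arg t _)

  extends-fin : ∀ {α n} → (t ′) [ α ] ∈ Δ → δ α ≡ fin n → f′ (fin n) ≡ δ ((t ′) [ α ])
  extends-fin {α} {zero}  t′α∈Δ δα≡ = trans F′.zero-pres (sym (c2 (t ′) α t′α∈Δ δα≡))
  extends-fin {n = suc _} t′α∈Δ δα≡ =
    f′-at-suc (f-below t′α∈Δ δα≡) (f-above t′α∈Δ δα≡)

  extends-ω : ∀ {α} → (t ′) [ α ] ∈ Δ → δ α ≡ ω → f′ ω ≡ δ ((t ′) [ α ])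
  extends-ω {α} t′α∈Δ δα≡ω with δ (lastS (t ′)) in last-t′≡
  ... | fin n = f′-at-ω f′n≡c λ c<ω → ω≤w⇒≡ω (f-above t′α∈Δ δα≡ω c<ω)
    where
    f′n≡c : f′ (fin n) ≡ δ ((t ′) [ α ])
    f′n≡c = trans (extends-fin (t′[last-t′]∈Δ t′α∈Δ) last-t′≡)
                  (c4⇒ (t ′) α t′α∈Δ (subst (δ (lastS (t ′)) ≤w_) (sym δα≡ω) ≤ω))
  ... | ω = trans (f′-unbounded finite) (sym (≮ω⇒≡ω c≮ω))
    where
    finite : ∀ n → f (fin n) <w ω
    finite = isLast-ω⇒finite tw (isLast-f t′α∈Δ last-t′≡)
    c≮ω : ¬ δ ((t ′) [ α ]) <w ω
    c≮ω c<ω = <ω⇒≢ω (finite-S c<ω) (ω≤w⇒≡ω (f-above t′α∈Δ δα≡ω c<ω))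
      where
      finite-S : ∀ {x} → x <w ω → f (S x) <w ω
      finite-S {fin j} fin<ω = finite (suc j)

  extends : Extends Δ δ (t ′) f′
  extends α t′α∈Δ with δ α in δα≡
  ... | fin n = extends-fin t′α∈Δ δα≡
  ... | ω     = extends-ω t′α∈Δ δα≡

  strongly-extends : StronglyExtends Δ δ (t ′) f′
  strongly-extends = extends , λ (_ , t′α∈Δ) last-t′≡ω → isLast-ω-derivative (isLast-f t′α∈Δ last-t′≡ω)

lemma3p6 : (Δ : List Sample) (δ : Sample → ω⁺) (t : Term) (f f′ : ω⁺ → ω⁺) →
    Saturated Δ → IsDiagram Δ δ → TimeWarp f → IsDerivative f f′ →
    StronglyExtends Δ δ t f → StronglyExtends Δ δ (t ′) f′
lemma3p6 _ _ _ _ _ sat D tw der SE = Lemma3p6.strongly-extends sat D tw der SE
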